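{- Let $d\ge 2$ and $n\ge 1$ be integers. Then $$p^{(d)}(n)=\sum_{i\ge 1}\hat{p}^{(1)}_i\!\left(n-(d-2)\binom{i}{2}\right),$$ where $p^{(d)}(n)$ is the number of partitions of $n$ with $d$-distant parts and, for an integer $m$ and $i\ge1$, $\hat{p}^{(1)}_i(m)$ is the number of partitions of $m$ into exactly $i$ distinct parts whose smallest even part is greater than twice the number of odd parts (with $\hat{p}^{(1)}_i(m)=0$ for $m\le 0$). Only the terms with $1\le i\le l(n,d)$ can be nonzero, where $l(n,d)$ is the maximal length of a partition of $n$ with $d$-distant parts.
   Context: A partition of $n$ is a non-increasing sequence of positive integers $\lambda_1\ge\cdots\ge\lambda_l$ summing to $n$; it has $d$-distant parts if $\lambda_j-\lambda_{j+1}\ge d$ for all $j<l$ (so $1$-distant means all parts are distinct). For a partition $\mu$ with distinct parts, $l_o(\mu)$ denotes its number of odd parts and $e(\mu)$ its smallest even part; the condition "smallest even part greater than twice the number of odd parts" means $e(\mu)>2l_o(\mu)$, and it is regarded as satisfied when $\mu$ has no even parts. -}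

module Defs where

open import Data.Nat using (ℕ; zero; suc; _+_; _*_; _∸_; _≤ᵇ_; _<ᵇ_; _≡ᵇ_; _⊔_)
open import Data.Nat.Combinatorics using (_C_)
open import Data.Bool using (Bool; true; false; _∧_; not; if_then_else_)
open import Data.Nat.ListAction using (sum)
open import Data.List using (List; []; _∷_; length; map; concatMap; filterᵇ; applyUpTo; foldr)
open import Data.Maybe using (Maybe; just; nothing)

oneTo : ℕ → List ℕ
oneTo n = applyUpTo suc n

listsOfLength : ℕ → List ℕ → List (List ℕ)
listsOfLength zero    xs = [] ∷ []
listsOfLength (suc L) xs = concatMap (λ x → map (x ∷_) (listsOfLength L xs)) xs

-- candidate lists: all lists of length ≤ n with entries in {1..n}.
-- Every partition of n occurs exactly once among them.
candidates : ℕ → List (List ℕ)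
candidates n = concatMap (λ L → listsOfLength L (oneTo n)) (applyUpTo (λ k → k) (suc n))

nonIncreasing : List ℕ → Bool
nonIncreasing (x ∷ y ∷ r) = (y ≤ᵇ x) ∧ nonIncreasing (y ∷ r)
nonIncreasing _ = true

allPositive : List ℕ → Bool
allPositive [] = true
allPositive (x ∷ r) = (0 <ᵇ x) ∧ allPositive r

isPartitionOf : ℕ → List ℕ → Bool
isPartitionOf n l = nonIncreasing l ∧ allPositive l ∧ (sum l ≡ᵇ n)

partitions : ℕ → List (List ℕ)
partitions n = filterᵇ (isPartitionOf n) (candidates n)

dDistant : ℕ → List ℕ → Bool
dDistant d (x ∷ y ∷ r) = (y + d ≤ᵇ x) ∧ dDistant d (y ∷ r)
dDistant d _ = true

distinctParts : List ℕ → Bool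
distinctParts = dDistant 1

isEven : ℕ → Bool
isEven zero = true
isEven (suc zero) = false
isEven (suc (suc n)) = isEven n

numOdd : List ℕ → ℕ
numOdd [] = 0
numOdd (x ∷ r) = if isEven x then numOdd r else suc (numOdd r)

minMaybe : ℕ → Maybe ℕ → ℕ
minMaybe x nothing = x
minMaybe x (just y) = if x ≤ᵇ y then x else y

smallestEven : List ℕ → Maybe ℕ
smallestEven [] = nothing
smallestEven (x ∷ r) = if isEven x then just (minMaybe x (smallestEven r)) else smallestEven r

evenCondition : List ℕ → Bool
evenCondition μ with smallestEven μ
... | nothing = true
... | just e  = 2 * numOdd μ <ᵇ e

pDistant : ℕ → ℕ → ℕ
pDistant d n = length (filterᵇ (dDistant d) (partitions n))

pHat : ℕ → ℕ → ℕ
pHat i m = length (filterᵇ (λ μ → distinctParts μ ∧ (length μ ≡ᵇ i) ∧ evenCondition μ) (partitions m))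

-- the term p̂^(1)_i(n - (d-2) C(i,2)), which is 0 when the argument is ≤ 0
hatTerm : ℕ → ℕ → ℕ → ℕ
hatTerm d n i = if n ≤ᵇ (d ∸ 2) * (i C 2) then 0 else pHat i (n ∸ (d ∸ 2) * (i C 2))

maxLength : ℕ → ℕ → ℕ
maxLength n d = foldr _⊔_ 0 (map length (filterᵇ (dDistant d) (partitions n)))

sumFrom1 : ℕ → (ℕ → ℕ) → ℕ
sumFrom1 zero f = 0
sumFrom1 (suc k) f = sumFrom1 k f + f (suc k)

module Submission where

-- Write d = 2 + e and let λ be a d-distant partition of n into i parts.  Subtracting the
-- staircase 1 + d·(i − j) from the j-th largest part leaves a non-increasing sequence ν ≥ 0 of
-- length i with |λ| = |ν| + i + d·C(i,2).  Send the b even parts of ν to distinct odd numbers by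
-- adding the staircase 1, 3, 5, … and the odd parts of ν to distinct even numbers by adding
-- 2b + 1, 2b + 3, …; merged, these form a partition μ into i distinct parts whose even parts all
-- exceed 2b = 2·l_o(μ), with |μ| = |ν| + i + 2·C(i,2) = n − e·C(i,2).  The parity of a part of μ
-- tells which staircase to remove, so this is a bijection; summing over the number of parts
-- i ≤ l(n,d) gives the theorem.

open import Defs
open import Data.Bool using (Bool; true; false; T; not; _∧_; if_then_else_)
open import Data.Bool.Properties using (T-∧; T?; T-not-≡; not-involutive)
open import Data.List using (List; []; _∷_; _++_; length; map; filter; filterᵇ; merge; applyUpTo; foldr)
open import Data.List.Membership.Propositional using (_∈_)
open import Data.List.Membership.Propositional.Properties
  using (∈-filter⁺; ∈-filter⁻; ∈-map⁺; ∈-map⁻; ∈-∃++; ∈-++⁻; ∈-++⁺ˡ; ∈-++⁺ʳ; ∈-concat⁺′; ∈-concat⁻′; ∈-applyUpTo⁺)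
open import Data.List.Properties using (length-++; length-map; filter-none; filter-all; filter-accept; filter-reject)
open import Data.List.Relation.Binary.Disjoint.Propositional using (Disjoint)
open import Data.List.Relation.Binary.Permutation.Propositional using (_↭_; ↭⇒↭ₛ; ↭-refl; ↭-sym; ↭-trans; ↭-prep)
open import Data.List.Relation.Binary.Permutation.Propositional.Properties
  using (↭-length; All-resp-↭; merge-↭) renaming (shift to ↭-shift)
import Data.List.Relation.Binary.Permutation.Setoid.Properties as PermutationSetoid
open import Data.List.Relation.Binary.Pointwise using (Pointwise-≡⇒≡)
open import Data.List.Relation.Binary.Subset.Propositional using (_⊆_)
open import Data.List.Relation.Unary.All as All using (All; []; _∷_)
import Data.List.Relation.Unary.All.Properties as All
open import Data.List.Relation.Unary.AllPairs as AllPairs using ()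
import Data.List.Relation.Unary.AllPairs.Properties as AllPairs
open import Data.List.Relation.Unary.Any using (here; there)
open import Data.List.Relation.Unary.Linked as Linked using (Linked; []; [-]; _∷_)
import Data.List.Relation.Unary.Linked.Properties as Linked
import Data.List.Relation.Unary.Sorted.TotalOrder.Properties as Sorted
open import Data.List.Relation.Unary.Unique.Propositional using (Unique; []; _∷_)
import Data.List.Relation.Unary.Unique.Propositional.Properties as Unique
open import Data.Maybe using (Maybe; just; nothing)
open import Data.Nat using (ℕ; zero; suc; _+_; _*_; _∸_; _≤_; _<_; _≤ᵇ_; _≡ᵇ_; _⊔_; _≥?_; z≤n; s≤s)
open import Data.Nat.Combinatorics using (_C_; nC1≡n; nCk+nC[k+1]≡[n+1]C[k+1])
open import Data.Nat.ListAction using (sum)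
open import Data.Nat.ListAction.Properties using (sum-++; sum-↭)
open import Data.Nat.Properties
open import Data.Nat.Tactic.RingSolver using (solve-∀)
open import Data.Product using (_×_; _,_; proj₂)
open import Data.Sum using (inj₁; inj₂)
open import Function using (_∘_; _⇔_; mk⇔; Equivalence)
import Relation.Binary.Construct.Flip.EqAndOrd as Flip
open import Relation.Binary.Definitions using (Decidable)
open import Relation.Binary.PropositionalEquality
  using (_≡_; _≢_; refl; sym; trans; cong; cong₂; subst; setoid; ≢-sym; module ≡-Reasoning)
open import Relation.Nullary using (¬_; does; contradiction)
open import Relation.Nullary.Reflects using (ofʸ; ofⁿ)
import Relation.Unary as U

open Equivalence using (to; from)

private
  variable
    a c d e i j k m n x : ℕ
    l xs ys : List ℕ

-- Written k + y ≤ x so that Distant 0 and Distant 1 are definitionally Linked _≥_ and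
-- Linked _>_, as the library's results on sorted lists expect.
Distant : ℕ → List ℕ → Set
Distant k = Linked (λ x y → k + y ≤ x)

Distant-weaken : j ≤ k → Distant k l → Distant j l
Distant-weaken j≤k = Linked.map (≤-trans (+-monoˡ-≤ _ j≤k))

dDistant⇒Distant : ∀ k l → T (dDistant k l) → Distant k l
dDistant⇒Distant k []          _ = []
dDistant⇒Distant k (x ∷ [])    _ = [-]
dDistant⇒Distant k (x ∷ y ∷ l) t =
  let gap , rest = to T-∧ t in subst (_≤ x) (+-comm y k) (≤ᵇ⇒≤ _ _ gap) ∷ dDistant⇒Distant k (y ∷ l) rest

Distant⇒dDistant : ∀ k {l} → Distant k l → T (dDistant k l)
Distant⇒dDistant k []                   = _
Distant⇒dDistant k [-]                  = _
Distant⇒dDistant k {x ∷ y ∷ _} (gap ∷ rest) =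
  from T-∧ (≤⇒≤ᵇ (subst (_≤ x) (+-comm k y) gap) , Distant⇒dDistant k rest)

nonIncreasing⇒Distant₀ : ∀ l → T (nonIncreasing l) → Distant 0 l
nonIncreasing⇒Distant₀ []          _ = []
nonIncreasing⇒Distant₀ (x ∷ [])    _ = [-]
nonIncreasing⇒Distant₀ (x ∷ y ∷ l) t =
  let gap , rest = to T-∧ t in ≤ᵇ⇒≤ _ _ gap ∷ nonIncreasing⇒Distant₀ (y ∷ l) rest

Distant₀⇒nonIncreasing : Distant 0 l → T (nonIncreasing l)
Distant₀⇒nonIncreasing []           = _
Distant₀⇒nonIncreasing [-]          = _
Distant₀⇒nonIncreasing (gap ∷ rest) = from T-∧ (≤⇒≤ᵇ gap , Distant₀⇒nonIncreasing rest)

allPositive⇒All : ∀ l → T (allPositive l) → All (0 <_) l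
allPositive⇒All []      _ = []
allPositive⇒All (x ∷ l) t = let pos , rest = to T-∧ t in <ᵇ⇒< 0 x pos ∷ allPositive⇒All l rest

All⇒allPositive : All (0 <_) l → T (allPositive l)
All⇒allPositive []           = _
All⇒allPositive (pos ∷ rest) = from T-∧ (<⇒<ᵇ pos , All⇒allPositive rest)

Partition : List ℕ → Set
Partition l = Distant 0 l × All (0 <_) l

isPartitionOf⇔ : T (isPartitionOf n l) ⇔ (Partition l × sum l ≡ n)
isPartitionOf⇔ {n} {l} = mk⇔
  (λ t → let ni , rest = to T-∧ t ; ap , s = to T-∧ rest in
    (nonIncreasing⇒Distant₀ l ni , allPositive⇒All l ap) , ≡ᵇ⇒≡ _ _ s)
  (λ ((ni , ap) , s) → from T-∧ (Distant₀⇒nonIncreasing ni , from T-∧ (All⇒allPositive ap , ≡⇒≡ᵇ _ _ s)))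

length-∈-listsOfLength : ∀ L xs → l ∈ listsOfLength L xs → length l ≡ L
length-∈-listsOfLength zero    xs (here refl) = refl
length-∈-listsOfLength (suc L) xs l∈
  with ys , l∈ys , ys∈ ← ∈-concat⁻′ (map (λ x → map (x ∷_) (listsOfLength L xs)) xs) l∈
  with x , _ , refl ← ∈-map⁻ _ ys∈
  with l′ , l′∈ , refl ← ∈-map⁻ _ l∈ys
  = cong suc (length-∈-listsOfLength L xs l′∈)

∈-listsOfLength : ∀ xs → All (_∈ xs) l → l ∈ listsOfLength (length l) xs
∈-listsOfLength xs []                 = here refl
∈-listsOfLength xs (_∷_ {x} {l} x∈ l∈) =
  ∈-concat⁺′ (∈-map⁺ (x ∷_) (∈-listsOfLength xs l∈)) (∈-map⁺ (λ x → map (x ∷_) (listsOfLength (length l) xs)) x∈)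

listsOfLength-unique : ∀ L → Unique xs → Unique (listsOfLength L xs)
listsOfLength-unique zero    _    = [] ∷ []
listsOfLength-unique {xs} (suc L) xs! = Unique.concat⁺
  (All.tabulate λ l∈ → let x , _ , e = ∈-map⁻ _ l∈ in
    subst Unique (sym e) (Unique.map⁺ (λ { refl → refl }) (listsOfLength-unique L xs!)))
  (AllPairs.map⁺ (AllPairs.map disjoint xs!))
  where
  disjoint : ∀ {x y} → x ≢ y → ∀ {l} → ¬ (l ∈ map (x ∷_) (listsOfLength L xs) × l ∈ map (y ∷_) (listsOfLength L xs))
  disjoint x≢y (l∈x , l∈y) with ∈-map⁻ _ l∈x | ∈-map⁻ _ l∈y
  ... | _ , _ , refl | _ , _ , refl = x≢y refl

candidates-unique : Unique (candidates n)
candidates-unique {n} = Unique.concat⁺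
  (All.tabulate λ ls∈ → let L , _ , e = ∈-map⁻ (λ L → listsOfLength L (oneTo n)) {xs = applyUpTo (λ k → k) (suc n)} ls∈ in
    subst Unique (sym e) (listsOfLength-unique L (Unique.applyUpTo⁺₁ suc n (λ i<j _ → <⇒≢ i<j ∘ suc-injective))))
  (AllPairs.map⁺ (AllPairs.map disjoint (Unique.upTo⁺ (suc n))))
  where
  disjoint : i ≢ j → ∀ {l} → ¬ (l ∈ listsOfLength i (oneTo n) × l ∈ listsOfLength j (oneTo n))
  disjoint {i} {j} i≢j (l∈i , l∈j) = i≢j (trans (sym (length-∈-listsOfLength i _ l∈i)) (length-∈-listsOfLength j _ l∈j))

∈-candidates : length l ≤ n → All (λ x → 0 < x × x ≤ n) l → l ∈ candidates n
∈-candidates {l} {n} l≤n bounded = ∈-concat⁺′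
  (∈-listsOfLength (oneTo n) (All.map ∈-oneTo bounded))
  (∈-map⁺ (λ L → listsOfLength L (oneTo n)) (∈-applyUpTo⁺ (λ k → k) (s≤s l≤n)))
  where
  ∈-oneTo : 0 < x × x ≤ n → x ∈ oneTo n
  ∈-oneTo {suc x} (_ , x<n) = ∈-applyUpTo⁺ suc x<n

length≤sum : All (0 <_) l → length l ≤ sum l
length≤sum []           = z≤n
length≤sum (pos ∷ rest) = +-mono-≤ pos (length≤sum rest)

∈⇒≤sum : x ∈ l → x ≤ sum l
∈⇒≤sum {l = y ∷ l} (here refl) = m≤m+n y (sum l)
∈⇒≤sum {l = y ∷ l} (there x∈)  = ≤-trans (∈⇒≤sum x∈) (m≤n+m (sum l) y)

partitions-unique : Unique (partitions n)
partitions-unique {n} = Unique.filter⁺ (T? ∘ isPartitionOf n) (candidates-unique {n})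

∈-partitions : l ∈ partitions n ⇔ (Partition l × sum l ≡ n)
∈-partitions {l} {n} = mk⇔
  (to isPartitionOf⇔ ∘ proj₂ ∘ ∈-filter⁻ (T? ∘ isPartitionOf n) {xs = candidates n})
  (λ { p@((_ , pos) , refl) → ∈-filter⁺ (T? ∘ isPartitionOf n)
        (∈-candidates (length≤sum pos) (All.tabulate (λ {x} x∈ → All.lookup pos x∈ , ∈⇒≤sum x∈)))
        (from isPartitionOf⇔ p) })

Unique⇒length-≤ : {A : Set} {xs ys : List A} → Unique xs → xs ⊆ ys → length xs ≤ length ys
Unique⇒length-≤ [] _ = z≤n
Unique⇒length-≤ {xs = x ∷ xs} (x∉xs ∷ xs!) xs⊆ys
  with ys₁ , ys₂ , refl ← ∈-∃++ (xs⊆ys (here refl)) = begin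
    suc (length xs)             ≤⟨ s≤s (Unique⇒length-≤ xs! xs⊆ys₁ys₂) ⟩
    suc (length (ys₁ ++ ys₂))   ≡⟨ ↭-length (↭-sym (↭-shift x ys₁ ys₂)) ⟩
    length (ys₁ ++ x ∷ ys₂)     ∎
  where
  open ≤-Reasoning
  xs⊆ys₁ys₂ : xs ⊆ ys₁ ++ ys₂
  xs⊆ys₁ys₂ {z} z∈ with ∈-++⁻ ys₁ (xs⊆ys (there z∈))
  ... | inj₁ z∈ys₁          = ∈-++⁺ˡ z∈ys₁
  ... | inj₂ (here refl)    = contradiction refl (All.lookup x∉xs z∈)
  ... | inj₂ (there z∈ys₂)  = ∈-++⁺ʳ ys₁ z∈ys₂

record Correspondence (A B : List ℕ → Set) : Set where
  field
    forth      : List ℕ → List ℕ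
    back       : List ℕ → List ℕ
    forth-∈    : ∀ {l} → A l → B (forth l)
    back-∈     : ∀ {l} → B l → A (back l)
    back-forth : ∀ {l} → A l → back (forth l) ≡ l
    forth-back : ∀ {l} → B l → forth (back l) ≡ l

open Correspondence

_⨾_ : ∀ {A B C} → Correspondence A B → Correspondence B C → Correspondence A C
F ⨾ G = record
  { forth      = forth G ∘ forth F
  ; back       = back F ∘ back G
  ; forth-∈    = forth-∈ G ∘ forth-∈ F
  ; back-∈     = back-∈ F ∘ back-∈ G
  ; back-forth = λ a → trans (cong (back F) (back-forth G (forth-∈ F a))) (back-forth F a)
  ; forth-back = λ c → trans (cong (forth G) (forth-back F (back-∈ G c))) (forth-back G c)
  }

countPartitions : (List ℕ → Bool) → ℕ → ℕ
countPartitions p n = length (filterᵇ p (partitions n))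

module _ (p : List ℕ → Bool) (n : ℕ) where

  ∈-filterᵇ-partitions : l ∈ filterᵇ p (partitions n) ⇔ ((Partition l × T (p l)) × sum l ≡ n)
  ∈-filterᵇ-partitions = mk⇔
    (λ l∈ → let l∈n , pl = ∈-filter⁻ (T? ∘ p) {xs = partitions n} l∈ ; P , s = to ∈-partitions l∈n in (P , pl) , s)
    (λ ((P , pl) , s) → ∈-filter⁺ (T? ∘ p) (from ∈-partitions (P , s)) pl)

  filterᵇ-partitions-unique : Unique (filterᵇ p (partitions n))
  filterᵇ-partitions-unique = Unique.filter⁺ (T? ∘ p) (partitions-unique {n})

  countPartitions-zero : (∀ {l} → Partition l × T (p l) → sum l ≢ n) → countPartitions p n ≡ 0
  countPartitions-zero none = cong length (filter-none (T? ∘ p)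
    (All.tabulate λ l∈ pl → let P , s = to (∈-partitions {n = n}) l∈ in none (P , pl) s))

module _ {A B : List ℕ → Set} {p q : List ℕ → Bool}
         (A⇔ : ∀ {l} → (Partition l × T (p l)) ⇔ A l) (B⇔ : ∀ {l} → (Partition l × T (q l)) ⇔ B l)
         (φ : Correspondence A B) (δ : ℕ) (sum-forth : ∀ {l} → A l → sum l ≡ sum (forth φ l) + δ) where

  countPartitions-≡ : ∀ m → countPartitions p (m + δ) ≡ countPartitions q m
  countPartitions-≡ m = ≤-antisym
    (subst (_ ≤_) (length-map (back φ) (filterᵇ q (partitions m)))
      (Unique⇒length-≤ (filterᵇ-partitions-unique p (m + δ)) forth⊆))
    (subst (_ ≤_) (length-map (forth φ) (filterᵇ p (partitions (m + δ))))
      (Unique⇒length-≤ (filterᵇ-partitions-unique q m) back⊆))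
    where
    forth⊆ : filterᵇ p (partitions (m + δ)) ⊆ map (back φ) (filterᵇ q (partitions m))
    forth⊆ {l} l∈ =
      let P , s = to (∈-filterᵇ-partitions p (m + δ)) l∈ ; a = to A⇔ P
          s′ = +-cancelʳ-≡ δ _ m (trans (sym (sum-forth a)) s)
      in subst (_∈ _) (back-forth φ a) (∈-map⁺ (back φ) (from (∈-filterᵇ-partitions q m) (from B⇔ (forth-∈ φ a) , s′)))
    back⊆ : filterᵇ q (partitions m) ⊆ map (forth φ) (filterᵇ p (partitions (m + δ)))
    back⊆ {l} l∈ =
      let P , s = to (∈-filterᵇ-partitions q m) l∈ ; b = to B⇔ P ; a = back-∈ φ b
          s′ = trans (sum-forth a) (cong (_+ δ) (trans (cong sum (forth-back φ b)) s))
      in subst (_∈ _) (forth-back φ b) (∈-map⁺ (forth φ) (from (∈-filterᵇ-partitions p (m + δ)) (from A⇔ a , s′)))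

sumFrom1-cong : ∀ L {f g} → (∀ {i} → 1 ≤ i → i ≤ L → f i ≡ g i) → sumFrom1 L f ≡ sumFrom1 L g
sumFrom1-cong zero    _   = refl
sumFrom1-cong (suc L) f≗g = cong₂ _+_ (sumFrom1-cong L (λ 1≤i i≤L → f≗g 1≤i (m≤n⇒m≤1+n i≤L))) (f≗g (s≤s z≤n) ≤-refl)

sumFrom1-+ : ∀ L f g → sumFrom1 L (λ i → f i + g i) ≡ sumFrom1 L f + sumFrom1 L g
sumFrom1-+ zero    f g = refl
sumFrom1-+ (suc L) f g rewrite sumFrom1-+ L f g = +-shuffle (sumFrom1 L f) (sumFrom1 L g) (f (suc L)) (g (suc L))
  where
  +-shuffle : ∀ a b c d → a + b + (c + d) ≡ a + c + (b + d)
  +-shuffle = solve-∀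

sumFrom1-zero : ∀ L → sumFrom1 L (λ _ → 0) ≡ 0
sumFrom1-zero zero    = refl
sumFrom1-zero (suc L) = trans (+-identityʳ _) (sumFrom1-zero L)

indicator : Bool → ℕ
indicator b = if b then 1 else 0

indicator-true : ∀ {b} → T b → indicator b ≡ 1
indicator-true {true} _ = refl

indicator-false : ∀ {b} → ¬ T b → indicator b ≡ 0
indicator-false {true}  ¬t = contradiction _ ¬t
indicator-false {false} _  = refl

sumFrom1-indicator-< : ∀ L → L < m → sumFrom1 L (λ i → indicator (m ≡ᵇ i)) ≡ 0
sumFrom1-indicator-< zero    _   = refl
sumFrom1-indicator-< (suc L) L<m =
  cong₂ _+_ (sumFrom1-indicator-< L (<-trans (n<1+n L) L<m)) (indicator-false (>⇒≢ L<m ∘ ≡ᵇ⇒≡ _ _))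

sumFrom1-indicator : ∀ {L} → 1 ≤ m → m ≤ L → sumFrom1 L (λ i → indicator (m ≡ᵇ i)) ≡ 1
sumFrom1-indicator {L = zero}  (s≤s _) ()
sumFrom1-indicator {L = suc L} 1≤m m≤1+L with m≤n⇒m<n∨m≡n m≤1+L
... | inj₁ m<1+L = cong₂ _+_ (sumFrom1-indicator 1≤m (≤-pred m<1+L)) (indicator-false (<⇒≢ m<1+L ∘ ≡ᵇ⇒≡ _ _))
... | inj₂ refl  = cong₂ _+_ (sumFrom1-indicator-< L ≤-refl) (indicator-true (≡⇒≡ᵇ (suc L) (suc L) refl))

length-filterᵇ-∷ : ∀ (p : List ℕ → Bool) x xs → length (filterᵇ p (x ∷ xs)) ≡ indicator (p x) + length (filterᵇ p xs)
length-filterᵇ-∷ p x xs with p x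
... | true  = refl
... | false = refl

length-filterᵇ-by-length : ∀ p L xs → (∀ {x} → x ∈ xs → T (p x) → 1 ≤ length x × length x ≤ L) →
  length (filterᵇ p xs) ≡ sumFrom1 L (λ i → length (filterᵇ (λ x → p x ∧ (length x ≡ᵇ i)) xs))
length-filterᵇ-by-length p L []       _       = sym (sumFrom1-zero L)
length-filterᵇ-by-length p L (x ∷ xs) bounded = begin
  length (filterᵇ p (x ∷ xs))                          ≡⟨ length-filterᵇ-∷ p x xs ⟩
  indicator (p x) + length (filterᵇ p xs)              ≡⟨ cong₂ _+_ (sym split-head) (length-filterᵇ-by-length p L xs (bounded ∘ there)) ⟩
  sumFrom1 L (λ i → indicator (pᵢ i x)) + sumFrom1 L (λ i → length (filterᵇ (pᵢ i) xs))
                                                       ≡⟨ sym (sumFrom1-+ L _ _) ⟩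
  sumFrom1 L (λ i → indicator (pᵢ i x) + length (filterᵇ (pᵢ i) xs))
                                                       ≡⟨ sumFrom1-cong L (λ _ _ → sym (length-filterᵇ-∷ _ x xs)) ⟩
  sumFrom1 L (λ i → length (filterᵇ (pᵢ i) (x ∷ xs)))  ∎
  where
  open ≡-Reasoning
  pᵢ : ℕ → List ℕ → Bool
  pᵢ i x = p x ∧ (length x ≡ᵇ i)
  split-head : sumFrom1 L (λ i → indicator (pᵢ i x)) ≡ indicator (p x)
  split-head with p x in px
  ... | true  = let 1≤ , ≤L = bounded (here refl) (subst T (sym px) _) in sumFrom1-indicator 1≤ ≤L
  ... | false = sumFrom1-zero L

∈⇒≤foldr-⊔ : ∀ {n ns} → n ∈ ns → n ≤ foldr _⊔_ 0 ns
∈⇒≤foldr-⊔ {ns = m ∷ ns} (here refl) = m≤m⊔n m _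
∈⇒≤foldr-⊔ {ns = m ∷ ns} (there n∈) = ≤-trans (∈⇒≤foldr-⊔ n∈) (m≤n⊔m m _)

suc-C-2 : ∀ n → suc n C 2 ≡ n + n C 2
suc-C-2 n = trans (sym (nCk+nC[k+1]≡[n+1]C[k+1] n 1)) (cong (_+ n C 2) (nC1≡n n))

+-C-2 : ∀ a b → (a + b) C 2 ≡ a C 2 + b C 2 + a * b
+-C-2 zero    b = sym (+-identityʳ (b C 2))
+-C-2 (suc a) b = begin
  suc (a + b) C 2                       ≡⟨ suc-C-2 (a + b) ⟩
  a + b + (a + b) C 2                   ≡⟨ cong (a + b +_) (+-C-2 a b) ⟩
  a + b + (a C 2 + b C 2 + a * b)       ≡⟨ rearrange a b (a C 2) (b C 2) ⟩
  a + a C 2 + b C 2 + (b + a * b)       ≡⟨ cong (λ t → t + b C 2 + (b + a * b)) (sym (suc-C-2 a)) ⟩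
  suc a C 2 + b C 2 + suc a * b         ∎
  where
  open ≡-Reasoning
  rearrange : ∀ a b s t → a + b + (s + t + a * b) ≡ a + s + t + (b + a * b)
  rearrange = solve-∀

raise lower : ℕ → ℕ → List ℕ → List ℕ
raise k c []      = []
raise k c (x ∷ l) = x + (c + k * length l) ∷ raise k c l
lower k c []      = []
lower k c (x ∷ l) = x ∸ (c + k * length l) ∷ lower k c l

length-raise : ∀ k c l → length (raise k c l) ≡ length l
length-raise k c []      = refl
length-raise k c (x ∷ l) = cong suc (length-raise k c l)

length-lower : ∀ k c l → length (lower k c l) ≡ length l
length-lower k c []      = refl
length-lower k c (x ∷ l) = cong suc (length-lower k c l)

lower-raise : ∀ k c l → lower k c (raise k c l) ≡ l
lower-raise k c []      = refl
lower-raise k c (x ∷ l) rewrite length-raise k c l = cong₂ _∷_ (m+n∸n≡m x (c + k * length l)) (lower-raise k c l)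

offset-suc : ∀ k c L → c + k * suc L ≡ k + (c + k * L)
offset-suc = solve-∀

head-bound : ∀ {x} → Distant k (x ∷ l) → All (c ≤_) (x ∷ l) → c + k * length l ≤ x
head-bound {k} {[]} {c} {x} _ (c≤x ∷ _) = subst (_≤ x) (sym (trans (cong (c +_) (*-zeroʳ k)) (+-identityʳ c))) c≤x
head-bound {k} {y ∷ l} {c} {x} (gap ∷ dist) (_ ∷ bounded) = begin
  c + k * suc (length l)      ≡⟨ offset-suc k c (length l) ⟩
  k + (c + k * length l)      ≤⟨ +-monoʳ-≤ k (head-bound dist bounded) ⟩
  k + y                       ≤⟨ gap ⟩
  x                           ∎
  where open ≤-Reasoning

raise-lower : Distant k l → All (c ≤_) l → raise k c (lower k c l) ≡ l
raise-lower {k} {[]}    {c} _    _                    = refl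
raise-lower {k} {x ∷ l} {c} dist bounded@(_ ∷ bounded′) rewrite length-lower k c l =
  cong₂ _∷_ (m∸n+n≡m (head-bound dist bounded)) (raise-lower (Linked.tail dist) bounded′)

raise-≥ : ∀ k c l → All (c ≤_) (raise k c l)
raise-≥ k c []      = []
raise-≥ k c (x ∷ l) = ≤-trans (m≤m+n c _) (m≤n+m _ x) ∷ raise-≥ k c l

sum-raise : ∀ k c l → sum (raise k c l) ≡ sum l + (c * length l + k * (length l C 2))
sum-raise k c []      = sym (cong₂ _+_ (*-zeroʳ c) (*-zeroʳ k))
sum-raise k c (x ∷ l) = begin
  x + (c + k * L) + sum (raise k c l)               ≡⟨ cong (x + (c + k * L) +_) (sum-raise k c l) ⟩
  x + (c + k * L) + (sum l + (c * L + k * (L C 2))) ≡⟨ rearrange x c k L (sum l) (L C 2) ⟩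
  x + sum l + (c * suc L + k * (L + L C 2))         ≡⟨ cong (λ t → x + sum l + (c * suc L + k * t)) (sym (suc-C-2 L)) ⟩
  x + sum l + (c * suc L + k * (suc L C 2))         ∎
  where
  open ≡-Reasoning
  L = length l
  rearrange : ∀ x c k L s t → x + (c + k * L) + (s + (c * L + k * t)) ≡ x + s + (c * suc L + k * (L + t))
  rearrange = solve-∀

sum-lower : Distant k l → All (c ≤_) l → sum l ≡ sum (lower k c l) + (c * length l + k * (length l C 2))
sum-lower {k} {l} {c} dist bounded = begin
  sum l                          ≡⟨ cong sum (sym (raise-lower dist bounded)) ⟩
  sum (raise k c (lower k c l))  ≡⟨ sum-raise k c (lower k c l) ⟩
  sum (lower k c l) + (c * length (lower k c l) + k * (length (lower k c l) C 2))
                                 ≡⟨ cong (λ L → sum (lower k c l) + (c * L + k * (L C 2))) (length-lower k c l) ⟩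
  sum (lower k c l) + (c * length l + k * (length l C 2)) ∎
  where open ≡-Reasoning

gap-raise : ∀ j k a x y → (j + k + (y + a) ≤ x + (k + a)) ⇔ (j + y ≤ x)
gap-raise j k a x y = mk⇔
  (λ le → +-cancelʳ-≤ (k + a) (j + y) x (subst (_≤ x + (k + a)) (regroup j k a y) le))
  (λ le → subst (_≤ x + (k + a)) (sym (regroup j k a y)) (+-monoˡ-≤ (k + a) le))
  where
  regroup : ∀ j k a y → j + k + (y + a) ≡ j + y + (k + a)
  regroup = solve-∀

raise-Distant⁺ : ∀ c → Distant j l → Distant (j + k) (raise k c l)
raise-Distant⁺ {l = []}        c _            = []
raise-Distant⁺ {l = x ∷ []}    c _            = [-]
raise-Distant⁺ {j} {x ∷ y ∷ l} {k} c (gap ∷ dist) =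
  subst (j + k + (y + (c + k * length l)) ≤_) (cong (x +_) (sym (offset-suc k c (length l))))
    (from (gap-raise j k (c + k * length l) x y) gap)
  ∷ raise-Distant⁺ c dist

raise-Distant⁻ : ∀ c → Distant (j + k) (raise k c l) → Distant j l
raise-Distant⁻ {l = []}        c _            = []
raise-Distant⁻ {l = x ∷ []}    c _            = [-]
raise-Distant⁻ {j} {k} {x ∷ y ∷ l} c (gap ∷ dist) =
  to (gap-raise j k (c + k * length l) x y)
    (subst (j + k + (y + (c + k * length l)) ≤_) (cong (x +_) (offset-suc k c (length l))) gap)
  ∷ raise-Distant⁻ c dist

staircase : ∀ k c i → Correspondence (λ l → Distant k l × All (c ≤_) l × length l ≡ i)
                                     (λ ν → Distant 0 ν × length ν ≡ i)
staircase k c i = record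
  { forth      = lower k c
  ; back       = raise k c
  ; forth-∈    = forth-∈′
  ; back-∈     = back-∈′
  ; back-forth = λ (dist , bounded , _) → raise-lower dist bounded
  ; forth-back = λ {ν} _ → lower-raise k c ν
  }
  where
  forth-∈′ : Distant k l × All (c ≤_) l × length l ≡ i → Distant 0 (lower k c l) × length (lower k c l) ≡ i
  forth-∈′ {l} (dist , bounded , len) =
    raise-Distant⁻ c (subst (Distant k) (sym (raise-lower dist bounded)) dist) , trans (length-lower k c l) len
  back-∈′ : Distant 0 l × length l ≡ i → Distant k (raise k c l) × All (c ≤_) (raise k c l) × length (raise k c l) ≡ i
  back-∈′ {l} (dist , len) = raise-Distant⁺ c dist , raise-≥ k c l , trans (length-raise k c l) len

Even Odd : ℕ → Set
Even n = T (isEven n)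
Odd n  = T (not (isEven n))

evens odds : List ℕ → List ℕ
evens = filterᵇ isEven
odds  = filterᵇ (not ∘ isEven)

isEven-suc : ∀ n → isEven (suc n) ≡ not (isEven n)
isEven-suc zero          = refl
isEven-suc (suc zero)    = refl
isEven-suc (suc (suc n)) = isEven-suc n

isEven-+-2* : ∀ m r → isEven (m + 2 * r) ≡ isEven m
isEven-+-2* m zero    = cong isEven (+-identityʳ m)
isEven-+-2* m (suc r) = trans (cong isEven (two-more m r)) (isEven-+-2* m r)
  where
  two-more : ∀ m r → m + 2 * suc r ≡ suc (suc (m + 2 * r))
  two-more = solve-∀

isEven-+-odd : ∀ m → Odd a → isEven (m + a) ≡ not (isEven m)
isEven-+-odd zero          a-odd = to T-not-≡ a-odd
isEven-+-odd {a} (suc zero) a-odd = trans (isEven-suc a) (cong not (to T-not-≡ a-odd))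
isEven-+-odd (suc (suc m)) a-odd = isEven-+-odd m a-odd

Even⇒¬Odd : Even a → ¬ Odd a
Even⇒¬Odd {a} ev od = subst T (to T-not-≡ od) ev

Even⇒¬Even-suc : Even a → ¬ Even (suc a)
Even⇒¬Even-suc {a} ev ev′ = Even⇒¬Odd {a} ev (subst T (isEven-suc a) ev′)

Odd⇒¬Odd-suc : Odd a → ¬ Odd (suc a)
Odd⇒¬Odd-suc {a} od = Even⇒¬Odd {suc a} (subst T (sym (trans (isEven-suc a) (cong not (to T-not-≡ od)))) _)

module _ (a-odd : Odd a) where

  Even⇔Odd-+ : ∀ x → Even x ⇔ Odd (x + a)
  Even⇔Odd-+ x = mk⇔ (subst T (sym flipped)) (subst T flipped)
    where
    flipped : not (isEven (x + a)) ≡ isEven x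
    flipped = trans (cong not (isEven-+-odd x a-odd)) (not-involutive (isEven x))

  Odd⇔Even-+ : ∀ x → Odd x ⇔ Even (x + a)
  Odd⇔Even-+ x = mk⇔ (subst T (sym (isEven-+-odd x a-odd))) (subst T (isEven-+-odd x a-odd))

All-raise⇔ : ∀ {P Q : ℕ → Set} k c → (∀ x L → P x ⇔ Q (x + (c + k * L))) → ∀ l → All P l ⇔ All Q (raise k c l)
All-raise⇔ k c P⇔Q []      = mk⇔ (λ _ → []) (λ _ → [])
All-raise⇔ k c P⇔Q (x ∷ l) = mk⇔
  (λ { (p ∷ ps) → to (P⇔Q x (length l)) p ∷ to (All-raise⇔ k c P⇔Q l) ps })
  (λ { (q ∷ qs) → from (P⇔Q x (length l)) q ∷ from (All-raise⇔ k c P⇔Q l) qs })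

module _ (c-odd : Odd c) (k : ℕ) where

  private
    offset-odd : ∀ L → Odd (c + 2 * k * L)
    offset-odd L = subst (T ∘ not) (sym (trans (cong (isEven ∘ (c +_)) (*-assoc 2 k L)) (isEven-+-2* c (k * L)))) c-odd

  All-Even⇔All-Odd-raise : ∀ l → All Even l ⇔ All Odd (raise (2 * k) c l)
  All-Even⇔All-Odd-raise = All-raise⇔ (2 * k) c (λ x L → Even⇔Odd-+ (offset-odd L) x)

  All-Odd⇔All-Even-raise : ∀ l → All Odd l ⇔ All Even (raise (2 * k) c l)
  All-Odd⇔All-Even-raise = All-raise⇔ (2 * k) c (λ x L → Odd⇔Even-+ (offset-odd L) x)

Distant-trans : ∀ {k x y z} → k + y ≤ x → k + z ≤ y → k + z ≤ x
Distant-trans {k} {x} {y} x≫y y≫z = ≤-trans y≫z (≤-trans (m≤n+m y k) x≫y)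

Distant-filter : ∀ {P : ℕ → Set} (P? : U.Decidable P) → Distant k l → Distant k (filter P? l)
Distant-filter P? = Linked.filter⁺ P? Distant-trans

Distant₁⇒Distant₂ : ∀ {P : ℕ → Set} → (∀ {x} → P x → ¬ P (suc x)) → All P l → Distant 1 l → Distant 2 l
Distant₁⇒Distant₂ ¬P-suc _              []           = []
Distant₁⇒Distant₂ ¬P-suc _              [-]          = [-]
Distant₁⇒Distant₂ {x ∷ y ∷ l} ¬P-suc (px ∷ py ∷ ps) (y<x ∷ dist) with m≤n⇒m<n∨m≡n y<x
... | inj₁ 1+y<x = 1+y<x ∷ Distant₁⇒Distant₂ ¬P-suc (py ∷ ps) dist
... | inj₂ refl  = contradiction px (¬P-suc py)

mergeDesc : List ℕ → List ℕ → List ℕ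
mergeDesc = merge _≥?_

mergeDesc-↭ : ∀ xs ys → mergeDesc xs ys ↭ xs ++ ys
mergeDesc-↭ = merge-↭ _≥?_

Distant₀-mergeDesc : Distant 0 xs → Distant 0 ys → Distant 0 (mergeDesc xs ys)
Distant₀-mergeDesc = Sorted.merge⁺ (Flip.decTotalOrder ≤-decTotalOrder)

Distant₀-↭⇒≡ : Distant 0 xs → Distant 0 ys → xs ↭ ys → xs ≡ ys
Distant₀-↭⇒≡ xs↘ ys↘ xs↭ys = Pointwise-≡⇒≡ (Sorted.↗↭↗⇒≋ (Flip.totalOrder ≤-totalOrder) xs↘ ys↘ (↭⇒↭ₛ xs↭ys))

Distant₁⇒Unique : Distant 1 l → Unique l
Distant₁⇒Unique = AllPairs.map >⇒≢ ∘ Linked.Linked⇒AllPairs (λ y<x z<y → <-trans z<y y<x)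

Distant₀∧Unique⇒Distant₁ : Distant 0 l → Unique l → Distant 1 l
Distant₀∧Unique⇒Distant₁ []           _                       = []
Distant₀∧Unique⇒Distant₁ [-]          _                       = [-]
Distant₀∧Unique⇒Distant₁ (y≤x ∷ dist) ((x≢y ∷ _) ∷ distinct) =
  ≤∧≢⇒< y≤x (≢-sym x≢y) ∷ Distant₀∧Unique⇒Distant₁ dist distinct

Distant₁-mergeDesc : Distant 1 xs → Distant 1 ys → Disjoint xs ys → Distant 1 (mergeDesc xs ys)
Distant₁-mergeDesc {xs} {ys} xs↘ ys↘ disjoint = Distant₀∧Unique⇒Distant₁
  (Distant₀-mergeDesc (Distant-weaken z≤n xs↘) (Distant-weaken z≤n ys↘))
  (PermutationSetoid.Unique-resp-↭ (setoid ℕ) (↭⇒↭ₛ (↭-sym (mergeDesc-↭ xs ys)))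
    (Unique.++⁺ (Distant₁⇒Unique xs↘) (Distant₁⇒Unique ys↘) disjoint))

module _ {A : Set} {R : A → A → Set} (R? : Decidable R) {P : A → Set} (P? : U.Decidable P) where

  filter-merge-left : ∀ {xs ys} → All P xs → All (¬_ ∘ P) ys → filter P? (merge R? xs ys) ≡ xs
  filter-merge-left {[]}              _    ¬pys = filter-none P? ¬pys
  filter-merge-left {x ∷ xs} {[]}     pxs  _    = filter-all P? pxs
  filter-merge-left {x ∷ xs} {y ∷ ys} pxxs@(px ∷ pxs) ¬pyys@(¬py ∷ ¬pys)
    with does (R? x y) | filter-merge-left pxs ¬pyys | filter-merge-left pxxs ¬pys
  ... | true  | rec | _   = trans (filter-accept P? px) (cong (x ∷_) rec)
  ... | false | _   | rec = trans (filter-reject P? ¬py) rec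

  filter-merge-right : ∀ {xs ys} → All (¬_ ∘ P) xs → All P ys → filter P? (merge R? xs ys) ≡ ys
  filter-merge-right {[]}              _    pys = filter-all P? pys
  filter-merge-right {x ∷ xs} {[]}     ¬pxs _   = filter-none P? ¬pxs
  filter-merge-right {x ∷ xs} {y ∷ ys} ¬pxxs@(¬px ∷ ¬pxs) pyys@(py ∷ pys)
    with does (R? x y) | filter-merge-right ¬pxs pyys | filter-merge-right ¬pxxs pys
  ... | true  | rec | _   = trans (filter-reject P? ¬px) rec
  ... | false | _   | rec = trans (filter-accept P? py) (cong (y ∷_) rec)

filterᵇ-not-++-filterᵇ-↭ : ∀ {A : Set} (p : A → Bool) xs → filterᵇ (not ∘ p) xs ++ filterᵇ p xs ↭ xs
filterᵇ-not-++-filterᵇ-↭ p []       = ↭-refl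
filterᵇ-not-++-filterᵇ-↭ p (x ∷ xs) with p x
... | true  = ↭-trans (↭-shift x (filterᵇ (not ∘ p) xs) (filterᵇ p xs)) (↭-prep x (filterᵇ-not-++-filterᵇ-↭ p xs))
... | false = ↭-prep x (filterᵇ-not-++-filterᵇ-↭ p xs)

odds-++-evens-↭ : ∀ l → odds l ++ evens l ↭ l
odds-++-evens-↭ = filterᵇ-not-++-filterᵇ-↭ isEven

mergeDesc-odds-evens : Distant 0 l → mergeDesc (odds l) (evens l) ≡ l
mergeDesc-odds-evens {l} l↘ = Distant₀-↭⇒≡
  (Distant₀-mergeDesc (Distant-filter (T? ∘ not ∘ isEven) l↘) (Distant-filter (T? ∘ isEven) l↘)) l↘
  (↭-trans (mergeDesc-↭ (odds l) (evens l)) (odds-++-evens-↭ l))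

odds-mergeDesc : All Odd xs → All Even ys → odds (mergeDesc xs ys) ≡ xs
odds-mergeDesc odd even = filter-merge-left _≥?_ (T? ∘ not ∘ isEven) odd (All.map (λ {x} → Even⇒¬Odd {x}) even)

evens-mergeDesc : All Odd xs → All Even ys → evens (mergeDesc xs ys) ≡ ys
evens-mergeDesc odd even = filter-merge-right _≥?_ (T? ∘ isEven) (All.map (λ {x} od ev → Even⇒¬Odd {x} ev od) odd) even

IsMinimum : List ℕ → Maybe ℕ → Set
IsMinimum xs nothing  = xs ≡ []
IsMinimum xs (just e) = e ∈ xs × All (e ≤_) xs

smallestEven-isMinimum : ∀ μ → IsMinimum (evens μ) (smallestEven μ)
smallestEven-isMinimum []      = refl
smallestEven-isMinimum (x ∷ μ) with isEven x | smallestEven μ | smallestEven-isMinimum μ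
... | false | m       | min              = min
... | true  | nothing | evens≡[]         rewrite evens≡[] = here refl , ≤-refl ∷ []
... | true  | just e  | e∈ , e≤          with x ≤ᵇ e in x≤ᵇe
...   | true  = here refl , ≤-refl ∷ All.map (≤-trans (≤ᵇ⇒≤ x e (subst T (sym x≤ᵇe) _))) e≤
...   | false = there e∈ , <⇒≤ (≰⇒> (λ x≤e → subst T x≤ᵇe (≤⇒≤ᵇ x≤e))) ∷ e≤

evenCondition⇔ : ∀ μ → T (evenCondition μ) ⇔ All (2 * numOdd μ <_) (evens μ)
evenCondition⇔ μ with smallestEven μ | smallestEven-isMinimum μ
... | nothing | evens≡[] = mk⇔ (λ _ → subst (All _) (sym evens≡[]) []) (λ _ → _)
... | just e  | e∈ , e≤  = mk⇔ (λ t → All.map (<-≤-trans (<ᵇ⇒< _ e t)) e≤) (λ bound → <⇒<ᵇ (All.lookup bound e∈))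

numOdd≡length-odds : ∀ μ → numOdd μ ≡ length (odds μ)
numOdd≡length-odds []      = refl
numOdd≡length-odds (x ∷ μ) with isEven x
... | true  = numOdd≡length-odds μ
... | false = cong suc (numOdd≡length-odds μ)

EvenCondition : List ℕ → Set
EvenCondition μ = All (2 * length (odds μ) <_) (evens μ)

HatParts : ℕ → List ℕ → Set
HatParts i μ = Distant 1 μ × All (0 <_) μ × length μ ≡ i × EvenCondition μ

Odd-1+2* : ∀ m → Odd (1 + 2 * m)
Odd-1+2* m = subst (T ∘ not) (sym (trans (isEven-suc (2 * m)) (cong not (isEven-+-2* 0 m)))) _

length-odds+evens : ∀ l → length (odds l) + length (evens l) ≡ length l
length-odds+evens l = trans (sym (length-++ (odds l))) (↭-length (odds-++-evens-↭ l))

sum-odds+evens : ∀ l → sum (odds l) + sum (evens l) ≡ sum l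
sum-odds+evens l = trans (sym (sum-++ (odds l) (evens l))) (sum-↭ (odds-++-evens-↭ l))

swapParity : List ℕ → List ℕ
swapParity ν = mergeDesc (raise 2 1 (evens ν)) (raise 2 (1 + 2 * length (evens ν)) (odds ν))

swapParity⁻¹ : List ℕ → List ℕ
swapParity⁻¹ μ = mergeDesc (lower 2 (1 + 2 * length (odds μ)) (evens μ)) (lower 2 1 (odds μ))

module _ {ν} (ν↘ : Distant 0 ν) where
  private
    nₑ = length (evens ν)
    nₒ = length (odds ν)
    O = raise 2 1 (evens ν)
    E = raise 2 (1 + 2 * nₑ) (odds ν)

    O-odd : All Odd O
    O-odd = to (All-Even⇔All-Odd-raise (Odd-1+2* 0) 1 (evens ν)) (All.all-filter (T? ∘ isEven) ν)

    E-even : All Even E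
    E-even = to (All-Odd⇔All-Even-raise (Odd-1+2* nₑ) 1 (odds ν)) (All.all-filter (T? ∘ not ∘ isEven) ν)

    odds-swapParity : odds (swapParity ν) ≡ O
    odds-swapParity = odds-mergeDesc O-odd E-even

    evens-swapParity : evens (swapParity ν) ≡ E
    evens-swapParity = evens-mergeDesc O-odd E-even

  swapParity-HatParts : HatParts (length ν) (swapParity ν)
  swapParity-HatParts = distinct , positive , length-swap , condition
    where
    distinct : Distant 1 (swapParity ν)
    distinct = Distant₁-mergeDesc
      (Distant-weaken (s≤s z≤n) (raise-Distant⁺ 1 (Distant-filter (T? ∘ isEven) ν↘)))
      (Distant-weaken (s≤s z≤n) (raise-Distant⁺ (1 + 2 * nₑ) (Distant-filter (T? ∘ not ∘ isEven) ν↘)))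
      (λ {x} (x∈O , x∈E) → Even⇒¬Odd {x} (All.lookup E-even x∈E) (All.lookup O-odd x∈O))
    positive : All (0 <_) (swapParity ν)
    positive = All-resp-↭ (↭-sym (mergeDesc-↭ O E))
      (All.++⁺ (raise-≥ 2 1 (evens ν)) (All.map (<-≤-trans (s≤s z≤n)) (raise-≥ 2 (1 + 2 * nₑ) (odds ν))))
    length-swap : length (swapParity ν) ≡ length ν
    length-swap = begin
      length (swapParity ν)  ≡⟨ ↭-length (mergeDesc-↭ O E) ⟩
      length (O ++ E)        ≡⟨ length-++ O ⟩
      length O + length E    ≡⟨ cong₂ _+_ (length-raise 2 1 (evens ν)) (length-raise 2 (1 + 2 * nₑ) (odds ν)) ⟩
      nₑ + nₒ                ≡⟨ +-comm nₑ nₒ ⟩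
      nₒ + nₑ                ≡⟨ length-odds+evens ν ⟩
      length ν               ∎
      where open ≡-Reasoning
    condition : EvenCondition (swapParity ν)
    condition rewrite odds-swapParity | evens-swapParity | length-raise 2 1 (evens ν) =
      raise-≥ 2 (1 + 2 * nₑ) (odds ν)

  swapParity⁻¹-swapParity : swapParity⁻¹ (swapParity ν) ≡ ν
  swapParity⁻¹-swapParity rewrite odds-swapParity | evens-swapParity | length-raise 2 1 (evens ν)
    | lower-raise 2 (1 + 2 * nₑ) (odds ν) | lower-raise 2 1 (evens ν) = mergeDesc-odds-evens ν↘

  sum-swapParity : sum (swapParity ν) ≡ sum ν + (1 * length ν + 2 * (length ν C 2))
  sum-swapParity = begin
    sum (swapParity ν)                    ≡⟨ sum-↭ (mergeDesc-↭ O E) ⟩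
    sum (O ++ E)                          ≡⟨ sum-++ O E ⟩
    sum O + sum E                         ≡⟨ cong₂ _+_ (sum-raise 2 1 (evens ν)) (sum-raise 2 (1 + 2 * nₑ) (odds ν)) ⟩
    sum (evens ν) + (1 * nₑ + 2 * (nₑ C 2)) + (sum (odds ν) + ((1 + 2 * nₑ) * nₒ + 2 * (nₒ C 2)))
                                          ≡⟨ regroup (sum (odds ν)) (sum (evens ν)) nₒ nₑ (nₒ C 2) (nₑ C 2) ⟩
    sum (odds ν) + sum (evens ν) + (1 * (nₒ + nₑ) + 2 * (nₒ C 2 + nₑ C 2 + nₒ * nₑ))
                                          ≡⟨ cong₂ (λ s t → s + (1 * (nₒ + nₑ) + 2 * t)) (sum-odds+evens ν) (sym (+-C-2 nₒ nₑ)) ⟩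
    sum ν + (1 * (nₒ + nₑ) + 2 * ((nₒ + nₑ) C 2))
                                          ≡⟨ cong (λ L → sum ν + (1 * L + 2 * (L C 2))) (length-odds+evens ν) ⟩
    sum ν + (1 * length ν + 2 * (length ν C 2)) ∎
    where
    open ≡-Reasoning
    regroup : ∀ sₒ sₑ nₒ nₑ tₒ tₑ → sₑ + (1 * nₑ + 2 * tₑ) + (sₒ + ((1 + 2 * nₑ) * nₒ + 2 * tₒ))
                                  ≡ sₒ + sₑ + (1 * (nₒ + nₑ) + 2 * (tₒ + tₑ + nₒ * nₑ))
    regroup = solve-∀

module _ {μ} (μ↘ : Distant 1 μ) (μ-positive : All (0 <_) μ) (μ-condition : EvenCondition μ) where
  private
    o = length (odds μ)
    B = lower 2 1 (odds μ)
    A = lower 2 (1 + 2 * o) (evens μ)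

    odds↘ : Distant 2 (odds μ)
    odds↘ = Distant₁⇒Distant₂ (λ {x} → Odd⇒¬Odd-suc {x}) (All.all-filter (T? ∘ not ∘ isEven) μ)
      (Distant-filter (T? ∘ not ∘ isEven) μ↘)

    evens↘ : Distant 2 (evens μ)
    evens↘ = Distant₁⇒Distant₂ (λ {x} → Even⇒¬Even-suc {x}) (All.all-filter (T? ∘ isEven) μ)
      (Distant-filter (T? ∘ isEven) μ↘)

    raise-B : raise 2 1 B ≡ odds μ
    raise-B = raise-lower odds↘ (All.filter⁺ (T? ∘ not ∘ isEven) μ-positive)

    raise-A : raise 2 (1 + 2 * o) A ≡ evens μ
    raise-A = raise-lower evens↘ μ-condition

    B-even : All Even B
    B-even = from (All-Even⇔All-Odd-raise (Odd-1+2* 0) 1 B)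
      (subst (All Odd) (sym raise-B) (All.all-filter (T? ∘ not ∘ isEven) μ))

    A-odd : All Odd A
    A-odd = from (All-Odd⇔All-Even-raise (Odd-1+2* o) 1 A)
      (subst (All Even) (sym raise-A) (All.all-filter (T? ∘ isEven) μ))

    odds-swapParity⁻¹ : odds (swapParity⁻¹ μ) ≡ A
    odds-swapParity⁻¹ = odds-mergeDesc A-odd B-even

    evens-swapParity⁻¹ : evens (swapParity⁻¹ μ) ≡ B
    evens-swapParity⁻¹ = evens-mergeDesc A-odd B-even

  swapParity⁻¹-Distant₀ : Distant 0 (swapParity⁻¹ μ)
  swapParity⁻¹-Distant₀ = Distant₀-mergeDesc
    (raise-Distant⁻ (1 + 2 * o) (subst (Distant 2) (sym raise-A) evens↘))
    (raise-Distant⁻ 1 (subst (Distant 2) (sym raise-B) odds↘))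

  length-swapParity⁻¹ : length (swapParity⁻¹ μ) ≡ length μ
  length-swapParity⁻¹ = begin
    length (swapParity⁻¹ μ)                ≡⟨ ↭-length (mergeDesc-↭ A B) ⟩
    length (A ++ B)                        ≡⟨ length-++ A ⟩
    length A + length B                    ≡⟨ cong₂ _+_ (length-lower 2 (1 + 2 * o) (evens μ)) (length-lower 2 1 (odds μ)) ⟩
    length (evens μ) + o                   ≡⟨ +-comm (length (evens μ)) o ⟩
    o + length (evens μ)                   ≡⟨ length-odds+evens μ ⟩
    length μ                               ∎
    where open ≡-Reasoning

  swapParity-swapParity⁻¹ : swapParity (swapParity⁻¹ μ) ≡ μ
  swapParity-swapParity⁻¹ rewrite odds-swapParity⁻¹ | evens-swapParity⁻¹ | length-lower 2 1 (odds μ)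
    | raise-A | raise-B = mergeDesc-odds-evens (Distant-weaken z≤n μ↘)

swapParityCorrespondence : ∀ i → Correspondence (λ ν → Distant 0 ν × length ν ≡ i) (HatParts i)
swapParityCorrespondence i = record
  { forth      = swapParity
  ; back       = swapParity⁻¹
  ; forth-∈    = λ { (ν↘ , refl) → swapParity-HatParts ν↘ }
  ; back-∈     = λ (μ↘ , pos , len , cond) → swapParity⁻¹-Distant₀ μ↘ pos cond , trans (length-swapParity⁻¹ μ↘ pos cond) len
  ; back-forth = λ (ν↘ , _) → swapParity⁻¹-swapParity ν↘
  ; forth-back = λ (μ↘ , pos , _ , cond) → swapParity-swapParity⁻¹ μ↘ pos cond
  }

DistantParts : ℕ → ℕ → List ℕ → Set
DistantParts d i l = Distant d l × All (0 <_) l × length l ≡ i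

distantParts⇔ : (Partition l × T (dDistant d l ∧ (length l ≡ᵇ i))) ⇔ DistantParts d i l
distantParts⇔ {l} {d} = mk⇔
  (λ ((_ , pos) , t) → let dist , len = to T-∧ t in dDistant⇒Distant d l dist , pos , ≡ᵇ⇒≡ _ _ len)
  (λ (dist , pos , len) → (Distant-weaken z≤n dist , pos) , from T-∧ (Distant⇒dDistant d dist , ≡⇒≡ᵇ _ _ len))

hatParts⇔ : (Partition l × T (distinctParts l ∧ (length l ≡ᵇ i) ∧ evenCondition l)) ⇔ HatParts i l
hatParts⇔ {l} = mk⇔
  (λ ((_ , pos) , t) → let dist , rest = to T-∧ t ; len , cond = to T-∧ rest in
    dDistant⇒Distant 1 l dist , pos , ≡ᵇ⇒≡ _ _ len ,
    subst (λ o → All (2 * o <_) (evens l)) (numOdd≡length-odds l) (to (evenCondition⇔ l) cond))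
  (λ (dist , pos , len , cond) → (Distant-weaken z≤n dist , pos) ,
    from T-∧ (Distant⇒dDistant 1 dist , from T-∧ (≡⇒≡ᵇ _ _ len ,
      from (evenCondition⇔ l) (subst (λ o → All (2 * o <_) (evens l)) (sym (numOdd≡length-odds l)) cond))))

distantToHat : ∀ e i → Correspondence (DistantParts (2 + e) i) (HatParts i)
distantToHat e i = staircase (2 + e) 1 i ⨾ swapParityCorrespondence i

sum-distantToHat : DistantParts (2 + e) i l → sum l ≡ sum (forth (distantToHat e i) l) + e * (i C 2)
sum-distantToHat {e} {i} {l} (dist , pos , refl) = begin
  sum l                                         ≡⟨ sum-lower dist pos ⟩
  sum ν + (1 * length l + (2 + e) * (length l C 2)) ≡⟨ regroup (sum ν) (length l) (length l C 2) e ⟩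
  sum ν + (1 * length l + 2 * (length l C 2)) + e * (length l C 2)
                                                ≡⟨ cong (λ L → sum ν + (1 * L + 2 * (L C 2)) + e * (length l C 2)) (sym (length-lower (2 + e) 1 l)) ⟩
  sum ν + (1 * length ν + 2 * (length ν C 2)) + e * (length l C 2)
                                                ≡⟨ cong (_+ e * (length l C 2)) (sym (sum-swapParity ν↘)) ⟩
  sum (swapParity ν) + e * (length l C 2)       ∎
  where
  open ≡-Reasoning
  ν = lower (2 + e) 1 l
  ν↘ : Distant 0 ν
  ν↘ = raise-Distant⁻ 1 (subst (Distant (2 + e)) (sym (raise-lower dist pos)) dist)
  regroup : ∀ s L t e → s + (1 * L + (2 + e) * t) ≡ s + (1 * L + 2 * t) + e * t
  regroup = solve-∀

DistantParts⇒e*iC2<sum : 1 ≤ i → DistantParts (2 + e) i l → e * (i C 2) < sum l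
DistantParts⇒e*iC2<sum {i} {e} {l} 1≤i parts = begin-strict
  e * (i C 2)                                 <⟨ m<n+m (e * (i C 2)) (<-≤-trans 1≤i (length≤sum-hat)) ⟩
  sum (forth (distantToHat e i) l) + e * (i C 2) ≡⟨ sym (sum-distantToHat parts) ⟩
  sum l                                       ∎
  where
  open ≤-Reasoning
  length≤sum-hat : i ≤ sum (forth (distantToHat e i) l)
  length≤sum-hat = let _ , pos , len , _ = forth-∈ (distantToHat e i) parts in subst (_≤ _) len (length≤sum pos)

countPartitions-distant≡hatTerm : ∀ e n i → 1 ≤ i →
  countPartitions (λ l → dDistant (2 + e) l ∧ (length l ≡ᵇ i)) n ≡ hatTerm (2 + e) n i
countPartitions-distant≡hatTerm e n i 1≤i with n ≤ᵇ e * (i C 2) | ≤ᵇ-reflects-≤ n (e * (i C 2))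
... | true  | ofʸ n≤eC = countPartitions-zero _ n λ P sum≡n →
  <⇒≱ (DistantParts⇒e*iC2<sum 1≤i (to distantParts⇔ P)) (subst (_≤ e * (i C 2)) (sym sum≡n) n≤eC)
... | false | ofⁿ n≰eC = begin
  countPartitions p n                    ≡⟨ cong (countPartitions p) (sym (m∸n+n≡m (<⇒≤ (≰⇒> n≰eC)))) ⟩
  countPartitions p (n ∸ eC + eC)        ≡⟨ countPartitions-≡ distantParts⇔ hatParts⇔ (distantToHat e i) eC sum-distantToHat (n ∸ eC) ⟩
  pHat i (n ∸ eC)                        ∎
  where
  open ≡-Reasoning
  eC = e * (i C 2)
  p : List ℕ → Bool
  p l = dDistant (2 + e) l ∧ (length l ≡ᵇ i)

length-≤-maxLength : l ∈ partitions n → T (dDistant d l) → length l ≤ maxLength n d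
length-≤-maxLength {l} {n} {d} l∈ dist = ∈⇒≤foldr-⊔ (∈-map⁺ length (∈-filter⁺ (T? ∘ dDistant d) l∈ dist))

theorem3 : (d n : ℕ) → 2 ≤ d → 1 ≤ n →
    (pDistant d n ≡ sumFrom1 (maxLength n d) (hatTerm d n))
    × ((i : ℕ) → maxLength n d < i → hatTerm d n i ≡ 0)
theorem3 d@(suc (suc e)) n (s≤s (s≤s z≤n)) 1≤n = decomposition , vanishing
  where
  M = maxLength n d
  decomposition : pDistant d n ≡ sumFrom1 M (hatTerm d n)
  decomposition = trans
    (length-filterᵇ-by-length (dDistant d) M (partitions n) λ l∈ dist →
      nonempty (to ∈-partitions l∈) , length-≤-maxLength {n = n} l∈ dist)
    (sumFrom1-cong M λ 1≤i _ → countPartitions-distant≡hatTerm e n _ 1≤i)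
    where
    nonempty : Partition l × sum l ≡ n → 1 ≤ length l
    nonempty {x ∷ _} _            = s≤s z≤n
    nonempty {[]}    (_ , refl)   = 1≤n
  vanishing : (i : ℕ) → M < i → hatTerm d n i ≡ 0
  vanishing i M<i = trans (sym (countPartitions-distant≡hatTerm e n i (<-≤-trans (s≤s z≤n) M<i)))
    (countPartitions-zero _ n λ (P , t) sum≡n → let dist , len = to T-∧ t in
      <⇒≱ M<i (subst (_≤ M) (≡ᵇ⇒≡ _ _ len) (length-≤-maxLength {n = n} (from ∈-partitions (P , sum≡n)) dist)))
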